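{- Let $G$ be a connected finite simple graph with $|V(G)|\ge 3$. Then $D'(G)\le \det'(G)+1$.
   Context: The distinguishing index $D'(G)$ is the minimum number of colors in an edge coloring of $G$ such that the only automorphism of $G$ preserving all edge colors is the identity. For a graph with at most one isolated vertex and no $K_2$ component, an edge set $T$ is an edge determining set if the only automorphism $\phi$ with $\{\phi(u),\phi(v)\}=\{u,v\}$ for all $\{u,v\}\in T$ is the identity; $\det'(G)$ is the minimum size of such a set. -}

module Defs where

open import Data.Nat using (ℕ; zero; suc; _+_; _<ᵇ_)
open import Data.Fin using (Fin; toℕ)
open import Data.Bool using (Bool; true; false; _∧_; if_then_else_)
open import Data.List using (tabulate)
open import Data.Nat.ListAction using (sum)
open import Data.Product using (_×_; _,_; Σ)
open import Data.Sum using (_⊎_)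
open import Data.Empty using (⊥)
open import Relation.Binary.PropositionalEquality using (_≡_)
open import Data.Fin.Permutation public using (Permutation′; _⟨$⟩ʳ_)

record Graph (n : ℕ) : Set where
  field
    adj   : Fin n → Fin n → Bool
    sym   : ∀ u v → adj u v ≡ adj v u
    irref : ∀ u → adj u u ≡ false
open Graph public

Edge : ∀ {n} → Graph n → Fin n → Fin n → Set
Edge G u v = adj G u v ≡ true

data Reach {n} (G : Graph n) : Fin n → Fin n → Set where
  here : ∀ {u} → Reach G u u
  step : ∀ {u v w} → Edge G u v → Reach G v w → Reach G u w

Connected : ∀ {n} → Graph n → Set
Connected {n} G = ∀ (u v : Fin n) → Reach G u v

IsAut : ∀ {n} → Graph n → Permutation′ n → Set
IsAut G σ = ∀ u v → adj G (σ ⟨$⟩ʳ u) (σ ⟨$⟩ʳ v) ≡ adj G u v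

IsIdentity : ∀ {n} → Permutation′ n → Set
IsIdentity {n} σ = ∀ (x : Fin n) → σ ⟨$⟩ʳ x ≡ x

-- Edge colourings with k colours: a symmetric colour assignment on pairs
-- (only its values on edges matter).
record EdgeColouring {n} (G : Graph n) (k : ℕ) : Set where
  field
    col    : Fin n → Fin n → Fin k
    colSym : ∀ u v → col u v ≡ col v u
open EdgeColouring public

PreservesColours : ∀ {n} {G : Graph n} {k} → EdgeColouring G k → Permutation′ n → Set
PreservesColours {G = G} c σ =
  ∀ u v → Edge G u v → col c (σ ⟨$⟩ʳ u) (σ ⟨$⟩ʳ v) ≡ col c u v

Distinguishing : ∀ {n} {G : Graph n} {k} → EdgeColouring G k → Set
Distinguishing {n} {G} c =
  ∀ (σ : Permutation′ n) → IsAut G σ → PreservesColours c σ → IsIdentity σ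

EdgeDistinguishable : ∀ {n} → Graph n → ℕ → Set
EdgeDistinguishable G k = Σ (EdgeColouring G k) Distinguishing

IsDistinguishingIndex : ∀ {n} → Graph n → ℕ → Set
IsDistinguishingIndex G d =
  EdgeDistinguishable G d × (∀ k → EdgeDistinguishable G k → d Data.Nat.≤ k)

record EdgeSet {n} (G : Graph n) : Set where
  field
    mem    : Fin n → Fin n → Bool
    memSym : ∀ u v → mem u v ≡ mem v u
    memSub : ∀ u v → mem u v ≡ true → Edge G u v
open EdgeSet public

size : ∀ {n} {G : Graph n} → EdgeSet G → ℕ
size {n} T =
  sum (tabulate λ (u : Fin n) → sum (tabulate λ (v : Fin n) →
    if mem T u v ∧ (toℕ u <ᵇ toℕ v) then 1 else 0))

FixesEdge : ∀ {n} → Permutation′ n → Fin n → Fin n → Set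
FixesEdge φ u v =
  ((φ ⟨$⟩ʳ u ≡ u) × (φ ⟨$⟩ʳ v ≡ v)) ⊎ ((φ ⟨$⟩ʳ u ≡ v) × (φ ⟨$⟩ʳ v ≡ u))

Determining : ∀ {n} {G : Graph n} → EdgeSet G → Set
Determining {n} {G} T =
  ∀ (φ : Permutation′ n) → IsAut G φ →
    (∀ u v → mem T u v ≡ true → FixesEdge φ u v) → IsIdentity φ

IsEdgeDeterminingNumber : ∀ {n} → Graph n → ℕ → Set
IsEdgeDeterminingNumber G d =
  Σ (EdgeSet G) (λ T → Determining T × size T ≡ d) ×
  (∀ (T : EdgeSet G) → Determining T → d Data.Nat.≤ size T)

-- Give each edge of a minimum edge determining set T its own colour and every
-- other edge one further common colour; this uses det'(G) + 1 colours. An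
-- automorphism preserving these colours maps each edge of T to an edge of the
-- same colour, i.e. to itself, so it fixes T edgewise and, T being
-- determining, is the identity.
module Submission where

open import Defs hiding (sym)
open import Data.Nat using (ℕ; suc; _+_; _≤_; _<_; _<ᵇ_)
open import Data.Nat.Properties using (<ᵇ-reflects-<; <⇒<ᵇ; <-asym; ≮⇒≥; ≤-antisym)
open import Data.Nat.ListAction using (sum)
open import Data.Fin using (Fin; toℕ; zero; suc)
open import Data.Fin.Properties using (toℕ-injective; suc-injective; 0≢1+n) renaming (_≟_ to _≟ᶠ_)
open import Data.Bool using (true; false; _∧_; if_then_else_)
open import Data.Bool.Properties using (if-float; T-≡)
open import Data.List using (List; []; _∷_; [_]; concat; map; tabulate; length; lookup)
open import Data.List.Properties using (length-++; map-tabulate; tabulate-cong)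
open import Data.List.Relation.Unary.Any using (index; here)
open import Data.List.Relation.Unary.Any.Properties using (lookup-index)
open import Data.List.Membership.Propositional using (_∈_)
open import Data.List.Membership.Propositional.Properties using (∈-concat⁺′; ∈-tabulate⁺)
import Data.List.Membership.DecPropositional as DecMembership
open import Data.Product using (_×_; _,_; proj₁; proj₂)
open import Data.Product.Properties using (≡-dec)
open import Data.Sum using (_⊎_; inj₁; inj₂)
open import Data.Empty using (⊥-elim)
open import Relation.Nullary using (yes; no; ¬_)
open import Function.Bundles using (Equivalence)
open import Relation.Nullary.Reflects using (ofʸ; ofⁿ)
open import Relation.Binary.Definitions using (DecidableEquality)
open import Relation.Binary.PropositionalEquality using (_≡_; _≢_; refl; sym; trans; cong; cong₂; subst; module ≡-Reasoning)

length-concat : ∀ {A : Set} (xss : List (List A)) →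
  length (concat xss) ≡ sum (map length xss)
length-concat []         = refl
length-concat (xs ∷ xss) = trans (length-++ xs) (cong (length xs +_) (length-concat xss))

length-concat-tabulate : ∀ {A : Set} {k} (f : Fin k → List A) →
  length (concat (tabulate f)) ≡ sum (tabulate (λ i → length (f i)))
length-concat-tabulate f = trans (length-concat (tabulate f)) (cong sum (map-tabulate f length))

module _ {A : Set} (_≟_ : DecidableEquality A) (xs : List A) where
  open DecMembership _≟_ using (_∈?_)

  position : A → Fin (suc (length xs))
  position x with x ∈? xs
  ... | yes x∈xs = suc (index x∈xs)
  ... | no  _    = zero

  position-injective : ∀ {x y} → x ∈ xs → position y ≡ position x → y ≡ x
  position-injective {x} {y} x∈xs eq with x ∈? xs | y ∈? xs
  ... | no x∉xs | _        = ⊥-elim (x∉xs x∈xs)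
  ... | yes _   | no _     = ⊥-elim (0≢1+n eq)
  ... | yes p   | yes q    = begin
    y                       ≡⟨ lookup-index q ⟩
    lookup xs (index q)     ≡⟨ cong (lookup xs) (suc-injective eq) ⟩
    lookup xs (index p)     ≡⟨ lookup-index p ⟨
    x                       ∎
    where open ≡-Reasoning

module _ {n : ℕ} where

  sortPair : Fin n → Fin n → Fin n × Fin n
  sortPair u v = if toℕ u <ᵇ toℕ v then (u , v) else (v , u)

  ≮∧≯⇒≡ : ∀ {u v : Fin n} → ¬ toℕ u < toℕ v → ¬ toℕ v < toℕ u → u ≡ v
  ≮∧≯⇒≡ u≮v v≮u = toℕ-injective (≤-antisym (≮⇒≥ v≮u) (≮⇒≥ u≮v))

  sortPair-comm : ∀ u v → sortPair u v ≡ sortPair v u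
  sortPair-comm u v
    with toℕ u <ᵇ toℕ v | <ᵇ-reflects-< (toℕ u) (toℕ v)
       | toℕ v <ᵇ toℕ u | <ᵇ-reflects-< (toℕ v) (toℕ u)
  ... | true  | ofʸ u<v | true  | ofʸ v<u = ⊥-elim (<-asym u<v v<u)
  ... | true  | _       | false | _       = refl
  ... | false | _       | true  | _       = refl
  ... | false | ofⁿ u≮v | false | ofⁿ v≮u = cong₂ _,_ (sym u≡v) u≡v
    where u≡v = ≮∧≯⇒≡ u≮v v≮u

  sortPair-injective : ∀ x y u v → sortPair x y ≡ sortPair u v →
    ((x ≡ u) × (y ≡ v)) ⊎ ((x ≡ v) × (y ≡ u))
  sortPair-injective x y u v eq with toℕ x <ᵇ toℕ y | toℕ u <ᵇ toℕ v
  ... | true  | true  = inj₁ (cong proj₁ eq , cong proj₂ eq)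
  ... | true  | false = inj₂ (cong proj₁ eq , cong proj₂ eq)
  ... | false | true  = inj₂ (cong proj₂ eq , cong proj₁ eq)
  ... | false | false = inj₁ (cong proj₂ eq , cong proj₁ eq)

edge⇒distinct : ∀ {n} (G : Graph n) {u v} → Edge G u v → u ≢ v
edge⇒distinct G {u} u~u refl with trans (sym (irref G u)) u~u
... | ()

module _ {n : ℕ} {G : Graph n} (T : EdgeSet G) where

  cell : Fin n → Fin n → List (Fin n × Fin n)
  cell u v = if mem T u v ∧ (toℕ u <ᵇ toℕ v) then [ (u , v) ] else []

  row : Fin n → List (Fin n × Fin n)
  row u = concat (tabulate (cell u))

  edgeList : List (Fin n × Fin n)
  edgeList = concat (tabulate row)

  length-edgeList : length edgeList ≡ size T
  length-edgeList =
    trans (length-concat-tabulate row) (cong sum (tabulate-cong λ u →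
      trans (length-concat-tabulate (cell u)) (cong sum (tabulate-cong λ v →
        if-float length (mem T u v ∧ (toℕ u <ᵇ toℕ v))))))

  ∈-edgeList : ∀ u v → mem T u v ≡ true → toℕ u < toℕ v → (u , v) ∈ edgeList
  ∈-edgeList u v u~v u<v =
    ∈-concat⁺′ (∈-concat⁺′ uv∈cell (∈-tabulate⁺ v)) (∈-tabulate⁺ u)
    where
    uv∈cell : (u , v) ∈ cell u v
    uv∈cell = subst (λ b → (u , v) ∈ (if b then [ (u , v) ] else []))
      (sym (cong₂ _∧_ u~v (Equivalence.to T-≡ (<⇒<ᵇ u<v)))) (here refl)

  sortPair∈edgeList : ∀ u v → mem T u v ≡ true → sortPair u v ∈ edgeList
  sortPair∈edgeList u v u~v
    with toℕ u <ᵇ toℕ v | <ᵇ-reflects-< (toℕ u) (toℕ v)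
       | toℕ v <ᵇ toℕ u | <ᵇ-reflects-< (toℕ v) (toℕ u)
  ... | true  | ofʸ u<v | _     | _       = ∈-edgeList u v u~v u<v
  ... | false | _       | true  | ofʸ v<u = ∈-edgeList v u (trans (memSym T v u) u~v) v<u
  ... | false | ofⁿ u≮v | false | ofⁿ v≮u =
    ⊥-elim (edge⇒distinct G (memSub T u v u~v) (≮∧≯⇒≡ u≮v v≮u))

  edgeColouring : EdgeColouring G (suc (length edgeList))
  edgeColouring = record
    { col    = λ u v → position (≡-dec _≟ᶠ_ _≟ᶠ_) edgeList (sortPair u v)
    ; colSym = λ u v → cong (position (≡-dec _≟ᶠ_ _≟ᶠ_) edgeList) (sortPair-comm u v)
    }

  colour-preserving⇒fixes-edgeSet : ∀ σ → PreservesColours edgeColouring σ →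
    ∀ u v → mem T u v ≡ true → FixesEdge σ u v
  colour-preserving⇒fixes-edgeSet σ preserves u v u~v =
    sortPair-injective _ _ u v
      (position-injective (≡-dec _≟ᶠ_ _≟ᶠ_) edgeList (sortPair∈edgeList u v u~v)
        (preserves u v (memSub T u v u~v)))

  determining⇒edgeDistinguishable : Determining T → EdgeDistinguishable G (suc (size T))
  determining⇒edgeDistinguishable determining =
    subst (λ k → EdgeDistinguishable G (suc k)) length-edgeList
      (edgeColouring , λ σ aut preserves →
        determining σ aut (colour-preserving⇒fixes-edgeSet σ preserves))

theorem3 : ∀ {n} (G : Graph n) → 3 ≤ n → Connected G →
    ∀ (D d : ℕ) → IsDistinguishingIndex G D → IsEdgeDeterminingNumber G d →
    D ≤ suc d
theorem3 G _ _ D d (_ , D-minimal) ((T , T-determining , |T|≡d) , _) =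
  subst (λ k → D ≤ suc k) |T|≡d
    (D-minimal _ (determining⇒edgeDistinguishable T T-determining))
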